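{- Let $T$ be a tree of order $n$ and let $d_i$ denote the number of dominating sets of $T$ of size $i$. Then $$d_{\left\lceil\frac{n+2\Gamma(T)-2}{3}\right\rceil}\ge\cdots\ge d_{n-1}\ge d_n.$$
   Context: A dominating set of a graph $G=(V,E)$ is a set $S\subseteq V$ such that every vertex is in $S$ or adjacent to a vertex of $S$; it is minimal if no proper subset is dominating. $\Gamma(G)$ is the maximum size of a minimal dominating set. -}

module Defs where

open import Data.Bool using (Bool; true; false; _∧_)
open import Data.Nat using (ℕ; zero; suc; _≤_; _<_; _+_; _*_; _∸_)
open import Data.Nat.DivMod using (_/_)
open import Data.Fin using (Fin; _<?_)
open import Data.Fin.Properties using (all?; any?)
open import Data.Fin.Subset using (Subset; inside; outside; _∈_; _⊂_; ∣_∣)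
open import Data.Fin.Subset.Properties using (_∈?_)
open import Data.Vec using ([]; _∷_)
open import Data.List using (List; []; _∷_; map; _++_; length; filter; concatMap; allFin)
open import Data.Product using (Σ; ∃; ∃-syntax; _×_; _,_)
open import Data.Sum using (_⊎_)
open import Relation.Binary.PropositionalEquality using (_≡_)
open import Relation.Nullary using (¬_; Dec)
open import Relation.Nullary.Decidable using (_⊎-dec_; _×-dec_; ⌊_⌋)
open import Data.Bool.Properties using () renaming (_≟_ to _≟B_)
open import Data.Nat using () renaming (_≟_ to _≟ℕ_)

record Graph (n : ℕ) : Set where
  field
    adj     : Fin n → Fin n → Bool
    symm    : ∀ u v → adj u v ≡ adj v u
    irrefl  : ∀ v → adj v v ≡ false

open Graph public

Adj : ∀ {n} → Graph n → Fin n → Fin n → Set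
Adj G u v = adj G u v ≡ true

data Walk {n} (G : Graph n) : Fin n → Fin n → Set where
  nil  : ∀ {v} → Walk G v v
  cons : ∀ {u w v} → Adj G u w → Walk G w v → Walk G u v

Connected : ∀ {n} → Graph n → Set
Connected G = ∀ u v → Walk G u v

allPairs : ∀ n → List (Fin n × Fin n)
allPairs n = concatMap (λ u → map (λ v → (u , v)) (allFin n)) (allFin n)

edgeCount : ∀ {n} → Graph n → ℕ
edgeCount {n} G =
  length (filter (λ p → (Data.Product.proj₁ p <? Data.Product.proj₂ p)
                         ×-dec (adj G (Data.Product.proj₁ p) (Data.Product.proj₂ p) ≟B true))
                 (allPairs n))

IsTree : ∀ {n} → Graph n → Set
IsTree {n} G = 1 ≤ n × Connected G × edgeCount G ≡ n ∸ 1

Dominating : ∀ {n} → Graph n → Subset n → Set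
Dominating G S = ∀ v → v ∈ S ⊎ (∃[ u ] (u ∈ S × Adj G u v))

dominating? : ∀ {n} (G : Graph n) (S : Subset n) → Dec (Dominating G S)
dominating? G S = all? (λ v → (v ∈? S) ⊎-dec any? (λ u → (u ∈? S) ×-dec (adj G u v ≟B true)))

MinimalDominating : ∀ {n} → Graph n → Subset n → Set
MinimalDominating G S = Dominating G S × (∀ S′ → S′ ⊂ S → ¬ Dominating G S′)

IsUpperDominationNumber : ∀ {n} → Graph n → ℕ → Set
IsUpperDominationNumber G γ =
  (Σ _ λ S → MinimalDominating G S × ∣ S ∣ ≡ γ) ×
  (∀ S → MinimalDominating G S → ∣ S ∣ ≤ γ)

allSubsets : ∀ n → List (Subset n)
allSubsets zero = [] ∷ []
allSubsets (suc n) = map (outside ∷_) (allSubsets n) ++ map (inside ∷_) (allSubsets n)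

domCount : ∀ {n} → Graph n → ℕ → ℕ
domCount {n} G i = length (filter (λ S → dominating? G S ×-dec (∣ S ∣ ≟ℕ i)) (allSubsets n))

⌈_/3⌉ : ℕ → ℕ
⌈ m /3⌉ = (m + 2) / 3

-- Double count the pairs (S, v) with S a dominating set of size i + 1 such that S - v still
-- dominates: S ↦ S - v matches them with the pairs (D, v) with D a dominating set of size i and
-- v ∉ D, of which there are (n - i) d_i. It therefore suffices that every dominating set S of
-- size i + 1 has at most 2i + 1 - n essential vertices (those v with S - v not dominating).
-- Split S into Isolated (no neighbour in S) and Core. An essential vertex of Core has a private
-- neighbour, outside S and adjacent to no other vertex of S; it lies in Far, the vertices outside
-- S with no neighbour in Isolated, and distinct essential vertices have distinct private
-- neighbours, so #essential ≤ |Isolated| + |Far|. For each colour class C of a proper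
-- 2-colouring, Isolated ∪ ((Core ∪ Far) ∩ C) is independent, hence extends to a maximal
-- independent set, i.e. a minimal dominating set, and has at most Γ elements. Adding the bounds
-- for both classes gives |S| + #essential ≤ 2Γ, which for i ≥ ⌈(n + 2Γ - 2)/3⌉ is the claim.
-- A tree is 2-coloured by the parity of the breadth-first depth: ordering vertices by depth,
-- each non-root vertex has a smaller neighbour (its parent), so an edge inside one level would
-- force at least n edges.

module Submission where

open import Algebra.Properties.CommutativeMonoid.Sum as Sum using ()
open import Data.Bool using (Bool; true; false; not; if_then_else_)
open import Data.Bool.Properties using (not-¬; ¬-not) renaming (_≟_ to _≟ᵇ_)
open import Data.Empty using (⊥-elim)
open import Data.Fin using (Fin; zero; suc; _≟_; _<?_; fromℕ<) renaming (_<_ to _<ᶠ_)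
open import Data.Fin.Properties using (suc-injective; <-cmp; any?; ¬∀⟶∃¬) renaming (<⇒≢ to <⇒≢ᶠ)
open import Data.Fin.Subset using (Subset; inside; outside; _∈_; _∉_; _⊂_; ⁅_⁆; ∣_∣)
  renaming (∁ to ∁ˢ; _⊆_ to _⊆ˢ_)
open import Data.Fin.Subset.Properties
  using (_∈?_; ∣⁅x⁆∣≡1; x∈⁅x⁆; x∈⁅y⁆⇒x≡y; x≢y⇒x∉⁅y⁆; x∉⁅y⁆⇒x≢y; x∈∁p⇒x∉p; x∉p⇒x∈∁p; ∣∁p∣≡n∸∣p∣; ∣p∣≤n;
         p⊆q⇒∣p∣≤∣q∣)
open import Data.List using (List; []; _∷_; length; filter; map; _++_; concatMap; tabulate; allFin)
open import Data.List.Properties using (filter-++; length-++)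
open import Data.Nat using (ℕ; zero; suc; _+_; _*_; _∸_; _≤_; _<_; z≤n; s≤s; _/_; _%_; >-nonZero)
  renaming (_≟_ to _≟ℕ_)
open import Data.Nat.DivMod using (m≡m%n+[m/n]*n; m%n<n)
open import Data.Nat.Properties
  using (+-0-commutativeMonoid; +-commutativeSemigroup; +-comm; +-suc; +-identityʳ; *-distribʳ-+; ≤-refl;
         ≤-reflexive; ≤-antisym; ≮⇒≥; 1+n≰n; <⇒≢; n≤0⇒n≡0; +-mono-≤; +-monoˡ-≤; +-monoʳ-≤; *-monoˡ-≤;
         +-cancelʳ-≤; *-cancelʳ-≤; *-cancelˡ-≡; m+[n∸m]≡n; m<n⇒0<n∸m; m≤n+o⇒m∸n≤o; m≤n+m∸n;
         module ≤-Reasoning)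
import Data.Nat.Properties as ℕ
open import Data.Nat.Tactic.RingSolver using (solve-∀)
open import Algebra.Properties.CommutativeSemigroup +-commutativeSemigroup using ()
  renaming (interchange to +-interchange)
open import Data.Product using (_×_; _,_; proj₁; proj₂; ∃; ∃-syntax)
open import Data.Product.Relation.Binary.Lex.Strict using (×-Lex; ×-compare)
open import Data.Sum using (_⊎_; inj₁; inj₂)
open import Data.Vec using ([]; _∷_; _[_]≔_; lookup)
import Data.Vec as Vec
open import Data.Vec.Properties
  using ([]≔-minimal; []≔-updates; []≔-lookup; []=-injective; []=⇒lookup; lookup⇒[]=; lookup∘update′; lookup∘tabulate)
open import Function using (_∘_; id; case_of_)
open import Level using (Level; 0ℓ)
open import Relation.Binary using (Rel; Trichotomous; tri<; tri≈; tri>)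
open import Relation.Binary.Consequences using (tri⇒dec<)
import Relation.Binary.Construct.Flip.EqAndOrd as Flip
open import Relation.Binary.Definitions using () renaming (Decidable to Decidable₂)
open import Relation.Binary.PropositionalEquality
open import Relation.Nullary using (Dec; yes; no; does; ¬_; ¬?; contradiction)
open import Relation.Nullary.Decidable using (_×-dec_; _⊎-dec_; dec-true)
open import Relation.Unary using (Pred; Decidable; _⊆_; _∩_; _∪_; ∁; _⊥_)
open import Relation.Unary.Properties using (_∩?_; _∪?_; ∁?)

open import Defs

open Sum +-0-commutativeMonoid using (sum; sum-syntax; ∑-distrib-+; ∑-comm; sum-cong-≗; sum-replicate-zero)

private variable
  p q : Level
  m n : ℕ

indicator : {P : Set p} → Dec P → ℕ
indicator P? = if does P? then 1 else 0

indicator-cong : {P : Set p} {Q : Set q} → (P → Q) → (Q → P) →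
                 (P? : Dec P) (Q? : Dec Q) → indicator P? ≡ indicator Q?
indicator-cong f g (yes _)  (yes _)  = refl
indicator-cong f g (yes P)  (no ¬Q)  = contradiction (f P) ¬Q
indicator-cong f g (no ¬P)  (yes Q)  = contradiction (g Q) ¬P
indicator-cong f g (no _)   (no _)   = refl

∑-mono-≤ : {f g : Fin n → ℕ} → (∀ x → f x ≤ g x) → sum f ≤ sum g
∑-mono-≤ {zero}  f≤g = z≤n
∑-mono-≤ {suc n} f≤g = +-mono-≤ (f≤g zero) (∑-mono-≤ (f≤g ∘ suc))

count : {P : Pred (Fin n) p} → Decidable P → ℕ
count {n} P? = ∑[ x < n ] indicator (P? x)

module _ {P : Pred (Fin n) p} {Q : Pred (Fin n) q} (P? : Decidable P) (Q? : Decidable Q) where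

  count-cong : P ⊆ Q → Q ⊆ P → count P? ≡ count Q?
  count-cong P⊆Q Q⊆P = sum-cong-≗ (λ x → indicator-cong P⊆Q Q⊆P (P? x) (Q? x))

  count-mono : P ⊆ Q → count P? ≤ count Q?
  count-mono P⊆Q = ∑-mono-≤ pointwise
    where
    pointwise : ∀ x → indicator (P? x) ≤ indicator (Q? x)
    pointwise x with P? x | Q? x
    ... | yes Px | no ¬Qx = contradiction (P⊆Q Px) ¬Qx
    ... | yes _  | yes _  = ≤-refl
    ... | no _   | _      = z≤n

  count-split : count P? ≡ count (P? ∩? Q?) + count (P? ∩? ∁? Q?)
  count-split = trans (sum-cong-≗ pointwise)
    (∑-distrib-+ (indicator ∘ (P? ∩? Q?)) (indicator ∘ (P? ∩? ∁? Q?)))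
    where
    pointwise : ∀ x → indicator (P? x) ≡ indicator ((P? ∩? Q?) x) + indicator ((P? ∩? ∁? Q?) x)
    pointwise x with P? x | Q? x
    ... | yes _ | yes _ = refl
    ... | yes _ | no _  = refl
    ... | no _  | _     = refl

  count-∪ : P ⊥ Q → count (P? ∪? Q?) ≡ count P? + count Q?
  count-∪ P⊥Q = trans (sum-cong-≗ pointwise) (∑-distrib-+ (indicator ∘ P?) (indicator ∘ Q?))
    where
    pointwise : ∀ x → indicator ((P? ∪? Q?) x) ≡ indicator (P? x) + indicator (Q? x)
    pointwise x with P? x | Q? x
    ... | yes Px | yes Qx = contradiction (Px , Qx) P⊥Q
    ... | yes _  | no _   = refl
    ... | no _   | yes _  = refl
    ... | no _   | no _   = refl

count-×-const : {P : Pred (Fin n) p} {A : Set q} (P? : Decidable P) (A? : Dec A) →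
                count (λ x → P? x ×-dec A?) ≡ indicator A? * count P?
count-×-const {n} P? (yes a) = trans (count-cong (λ x → P? x ×-dec yes a) P? proj₁ (_, a)) (sym (+-identityʳ _))
count-×-const {n} P? (no ¬a) = trans (sum-cong-≗ (λ x → indicator-cong (¬a ∘ proj₂) ⊥-elim (P? x ×-dec no ¬a) (no id)))
                                 (sum-replicate-zero n)

indicator-*-mono : ∀ {A : Set p} {a b} → (A → a ≤ b) → (A? : Dec A) → indicator A? * a ≤ indicator A? * b
indicator-*-mono a≤b (yes a) = +-monoˡ-≤ 0 (a≤b a)
indicator-*-mono a≤b (no _)  = z≤n

∣p∣≡count∈ : (S : Subset n) → ∣ S ∣ ≡ count (_∈? S)
∣p∣≡count∈ []            = refl
∣p∣≡count∈ (inside ∷ S)  = cong suc (∣p∣≡count∈ S)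
∣p∣≡count∈ (outside ∷ S) = ∣p∣≡count∈ S

count-≡ : (a : Fin n) → count (_≟ a) ≡ 1
count-≡ a = begin
  count (_≟ a)       ≡⟨ count-cong (_≟ a) (_∈? ⁅ a ⁆) (λ { refl → x∈⁅x⁆ a }) (x∈⁅y⁆⇒x≡y a) ⟩
  count (_∈? ⁅ a ⁆)  ≡⟨ ∣p∣≡count∈ ⁅ a ⁆ ⟨
  ∣ ⁅ a ⁆ ∣          ≡⟨ ∣⁅x⁆∣≡1 a ⟩
  1                  ∎
  where open ≡-Reasoning

count-∉ : (D : Subset n) → count (λ v → ¬? (v ∈? D)) ≡ n ∸ ∣ D ∣
count-∉ {n} D = begin
  count (λ v → ¬? (v ∈? D))  ≡⟨ count-cong (λ v → ¬? (v ∈? D)) (_∈? ∁ˢ D) x∉p⇒x∈∁p x∈∁p⇒x∉p ⟩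
  count (_∈? ∁ˢ D)           ≡⟨ ∣p∣≡count∈ (∁ˢ D) ⟨
  ∣ ∁ˢ D ∣                   ≡⟨ ∣∁p∣≡n∸∣p∣ D ⟩
  n ∸ ∣ D ∣                  ∎
  where open ≡-Reasoning

count-≢ : (a : Fin n) → count (∁? (_≟ a)) ≡ n ∸ 1
count-≢ {n} a = begin
  count (∁? (_≟ a))            ≡⟨ count-cong (∁? (_≟ a)) (λ v → ¬? (v ∈? ⁅ a ⁆)) x≢y⇒x∉⁅y⁆ x∉⁅y⁆⇒x≢y ⟩
  count (λ v → ¬? (v ∈? ⁅ a ⁆)) ≡⟨ count-∉ ⁅ a ⁆ ⟩
  n ∸ ∣ ⁅ a ⁆ ∣                ≡⟨ cong (n ∸_) (∣⁅x⁆∣≡1 a) ⟩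
  n ∸ 1                        ∎
  where open ≡-Reasoning

module _ {P : Pred (Fin n) p} (P? : Decidable P) where

  count-remove : ∀ {a} → P a → count P? ≡ suc (count (P? ∩? ∁? (_≟ a)))
  count-remove {a} Pa = begin
    count P?                                            ≡⟨ count-split P? (_≟ a) ⟩
    count (P? ∩? (_≟ a)) + count (P? ∩? ∁? (_≟ a))      ≡⟨ cong (_+ count (P? ∩? ∁? (_≟ a))) just-a ⟩
    suc (count (P? ∩? ∁? (_≟ a)))                       ∎
    where
    open ≡-Reasoning
    just-a : count (P? ∩? (_≟ a)) ≡ 1
    just-a = trans (count-cong (P? ∩? (_≟ a)) (_≟ a) proj₂ (λ { refl → Pa , refl })) (count-≡ a)

  count-pos : ∀ {a} → P a → 1 ≤ count P?
  count-pos Pa rewrite count-remove Pa = s≤s z≤n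

count-≥2 : {P : Pred (Fin n) p} (P? : Decidable P) → ∀ {a b} → P a → P b → b ≢ a → 2 ≤ count P?
count-≥2 P? {a} Pa Pb b≢a rewrite count-remove P? Pa = s≤s (count-pos (P? ∩? ∁? (_≟ a)) (Pb , b≢a))

count-injection : {P : Pred (Fin m) p} {Q : Pred (Fin n) q} (P? : Decidable P) (Q? : Decidable Q)
                  (h : ∀ {x} → P x → Fin n) → (∀ {x} (Px : P x) → Q (h Px)) →
                  (∀ {x y} (Px : P x) (Py : P y) → h Px ≡ h Py → x ≡ y) → count P? ≤ count Q?
count-injection {zero}  P? Q? h h∈Q h-inj = z≤n
count-injection {suc m} P? Q? h h∈Q h-inj with P? zero
... | no _ = count-injection (P? ∘ suc) Q? h h∈Q (λ Px Py e → suc-injective (h-inj Px Py e))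
... | yes P0 = subst (suc (count (P? ∘ suc)) ≤_) (sym (count-remove Q? (h∈Q P0))) (s≤s rest)
  where
  rest : count (P? ∘ suc) ≤ count (Q? ∩? ∁? (_≟ h P0))
  rest = count-injection (P? ∘ suc) (Q? ∩? ∁? (_≟ h P0)) h
           (λ Px → h∈Q Px , λ e → case (h-inj Px P0 e) of λ ())
           (λ Px Py e → suc-injective (h-inj Px Py e))

length-filter-map : {A B : Set} {P : Pred B p} (P? : Decidable P) (f : A → B) (xs : List A) →
                    length (filter P? (map f xs)) ≡ length (filter (P? ∘ f) xs)
length-filter-map P? f []       = refl
length-filter-map P? f (x ∷ xs) with does (P? (f x))
... | true  = cong suc (length-filter-map P? f xs)
... | false = length-filter-map P? f xs

length-filter-++ : {A : Set} {P : Pred A p} (P? : Decidable P) (xs ys : List A) →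
                   length (filter P? (xs ++ ys)) ≡ length (filter P? xs) + length (filter P? ys)
length-filter-++ P? xs ys = trans (cong length (filter-++ P? xs ys)) (length-++ (filter P? xs))

length-filter-tabulate : {A : Set} {P : Pred A p} (P? : Decidable P) (f : Fin n → A) →
                         length (filter P? (tabulate f)) ≡ count (P? ∘ f)
length-filter-tabulate {n = zero}  P? f = refl
length-filter-tabulate {n = suc n} P? f with does (P? (f zero))
... | true  = cong suc (length-filter-tabulate P? (f ∘ suc))
... | false = length-filter-tabulate P? (f ∘ suc)

length-filter-concatMap-tabulate : {A B : Set} {P : Pred B p} (P? : Decidable P) (g : A → List B) (f : Fin n → A) →
  length (filter P? (concatMap g (tabulate f))) ≡ ∑[ u < n ] length (filter P? (g (f u)))
length-filter-concatMap-tabulate {n = zero}  P? g f = refl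
length-filter-concatMap-tabulate {n = suc n} P? g f =
  trans (length-filter-++ P? (g (f zero)) (concatMap g (tabulate (f ∘ suc))))
        (cong (length (filter P? (g (f zero))) +_) (length-filter-concatMap-tabulate P? g (f ∘ suc)))

∑ˢ : (Subset n → ℕ) → ℕ
∑ˢ {zero}  f = f []
∑ˢ {suc n} f = ∑ˢ (f ∘ (outside ∷_)) + ∑ˢ (f ∘ (inside ∷_))

∑ˢ-cong : {f g : Subset n → ℕ} → (∀ S → f S ≡ g S) → ∑ˢ f ≡ ∑ˢ g
∑ˢ-cong {zero}  f≡g = f≡g []
∑ˢ-cong {suc n} f≡g = cong₂ _+_ (∑ˢ-cong (f≡g ∘ (outside ∷_))) (∑ˢ-cong (f≡g ∘ (inside ∷_)))

∑ˢ-mono-≤ : {f g : Subset n → ℕ} → (∀ S → f S ≤ g S) → ∑ˢ f ≤ ∑ˢ g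
∑ˢ-mono-≤ {zero}  f≤g = f≤g []
∑ˢ-mono-≤ {suc n} f≤g = +-mono-≤ (∑ˢ-mono-≤ (f≤g ∘ (outside ∷_))) (∑ˢ-mono-≤ (f≤g ∘ (inside ∷_)))

∑ˢ-zero : ∑ˢ {n} (λ _ → 0) ≡ 0
∑ˢ-zero {zero}  = refl
∑ˢ-zero {suc n} = cong₂ _+_ (∑ˢ-zero {n}) (∑ˢ-zero {n})

∑ˢ-*ʳ : (f : Subset n → ℕ) (c : ℕ) → ∑ˢ (λ S → f S * c) ≡ ∑ˢ f * c
∑ˢ-*ʳ {zero}  f c = refl
∑ˢ-*ʳ {suc n} f c = trans (cong₂ _+_ (∑ˢ-*ʳ (f ∘ (outside ∷_)) c) (∑ˢ-*ʳ (f ∘ (inside ∷_)) c))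
                          (sym (*-distribʳ-+ c (∑ˢ (f ∘ (outside ∷_))) (∑ˢ (f ∘ (inside ∷_)))))

∑ˢ-∑-comm : (g : Subset n → Fin m → ℕ) → ∑ˢ (λ S → ∑[ v < m ] g S v) ≡ ∑[ v < m ] ∑ˢ (λ S → g S v)
∑ˢ-∑-comm {zero}  g = refl
∑ˢ-∑-comm {suc n} g = trans (cong₂ _+_ (∑ˢ-∑-comm (g ∘ (outside ∷_))) (∑ˢ-∑-comm (g ∘ (inside ∷_))))
  (sym (∑-distrib-+ (λ v → ∑ˢ (λ S → g (outside ∷ S) v)) (λ v → ∑ˢ (λ S → g (inside ∷ S) v))))

-- S ↦ S - v is a bijection from the subsets containing v onto those avoiding v.
∑ˢ-remove : (f : Subset n → ℕ) (v : Fin n) →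
            ∑ˢ (λ S → if does (v ∈? S) then f (S [ v ]≔ outside) else 0) ≡
            ∑ˢ (λ D → if does (v ∈? D) then 0 else f D)
∑ˢ-remove {suc n} f zero = begin
  ∑ˢ {n} (λ _ → 0) + ∑ˢ (f ∘ (outside ∷_))  ≡⟨ cong (_+ ∑ˢ (f ∘ (outside ∷_))) (∑ˢ-zero {n}) ⟩
  ∑ˢ (f ∘ (outside ∷_))                     ≡⟨ +-identityʳ _ ⟨
  ∑ˢ (f ∘ (outside ∷_)) + 0                 ≡⟨ cong (∑ˢ (f ∘ (outside ∷_)) +_) (∑ˢ-zero {n}) ⟨
  ∑ˢ (f ∘ (outside ∷_)) + ∑ˢ {n} (λ _ → 0)  ∎
  where open ≡-Reasoning
∑ˢ-remove {suc n} f (suc v) = cong₂ _+_ (∑ˢ-remove (f ∘ (outside ∷_)) v) (∑ˢ-remove (f ∘ (inside ∷_)) v)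

length-filter-allSubsets : {P : Pred (Subset n) p} (P? : Decidable P) →
                           length (filter P? (allSubsets n)) ≡ ∑ˢ (indicator ∘ P?)
length-filter-allSubsets {zero}  P? with does (P? [])
... | true  = refl
... | false = refl
length-filter-allSubsets {suc n} P? = begin
  length (filter P? (map (outside ∷_) (allSubsets n) ++ map (inside ∷_) (allSubsets n)))
    ≡⟨ length-filter-++ P? (map (outside ∷_) (allSubsets n)) (map (inside ∷_) (allSubsets n)) ⟩
  length (filter P? (map (outside ∷_) (allSubsets n))) + length (filter P? (map (inside ∷_) (allSubsets n)))
    ≡⟨ cong₂ _+_ (half outside) (half inside) ⟩
  ∑ˢ (indicator ∘ P?) ∎
  where
  open ≡-Reasoning
  half : ∀ s → length (filter P? (map (s ∷_) (allSubsets n))) ≡ ∑ˢ (indicator ∘ P? ∘ (s ∷_))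
  half s = trans (length-filter-map P? (s ∷_) (allSubsets n)) (length-filter-allSubsets (P? ∘ (s ∷_)))

∣p[x]≔inside∣≡1+∣p[x]≔outside∣ : (p : Subset n) (x : Fin n) → ∣ p [ x ]≔ inside ∣ ≡ suc ∣ p [ x ]≔ outside ∣
∣p[x]≔inside∣≡1+∣p[x]≔outside∣ (s ∷ p)       zero    = refl
∣p[x]≔inside∣≡1+∣p[x]≔outside∣ (inside ∷ p)  (suc x) = cong suc (∣p[x]≔inside∣≡1+∣p[x]≔outside∣ p x)
∣p[x]≔inside∣≡1+∣p[x]≔outside∣ (outside ∷ p) (suc x) = ∣p[x]≔inside∣≡1+∣p[x]≔outside∣ p x

module _ {x : Fin n} where

  ∈-update⁺ : ∀ {y s} {p : Subset n} → y ≢ x → y ∈ p → y ∈ p [ x ]≔ s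
  ∈-update⁺ {y} {p = p} y≢x y∈p = []≔-minimal p y x y≢x y∈p

  ∈-update⁻ : ∀ {y s} {p : Subset n} → y ≢ x → y ∈ p [ x ]≔ s → y ∈ p
  ∈-update⁻ {y} {s} {p} y≢x y∈ = lookup⇒[]= y p (trans (sym (lookup∘update′ y≢x p s)) ([]=⇒lookup y∈))

  ∈-inserted : (p : Subset n) → x ∈ p [ x ]≔ inside
  ∈-inserted p = []≔-updates p x

  ⊆-insert : (p : Subset n) → p ⊆ˢ p [ x ]≔ inside
  ⊆-insert p {y} y∈p with y ≟ x
  ... | yes refl = ∈-inserted p
  ... | no y≢x   = ∈-update⁺ y≢x y∈p

  ∉-removed : (p : Subset n) → x ∉ p [ x ]≔ outside
  ∉-removed p x∈ = case []=-injective x∈ ([]≔-updates p x) of λ ()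

  ∈-removed⁻ : ∀ {y} {p : Subset n} → y ∈ p [ x ]≔ outside → y ∈ p
  ∈-removed⁻ {y} {p} y∈ with y ≟ x
  ... | yes refl = contradiction y∈ (∉-removed p)
  ... | no y≢x   = ∈-update⁻ y≢x y∈

  ∣p∣≡1+∣p-x∣ : {p : Subset n} → x ∈ p → ∣ p ∣ ≡ suc ∣ p [ x ]≔ outside ∣
  ∣p∣≡1+∣p-x∣ {p} x∈p = begin
    ∣ p ∣                    ≡⟨ cong ∣_∣ ([]≔-lookup p x) ⟨
    ∣ p [ x ]≔ lookup p x ∣  ≡⟨ cong (λ s → ∣ p [ x ]≔ s ∣) ([]=⇒lookup x∈p) ⟩
    ∣ p [ x ]≔ inside ∣      ≡⟨ ∣p[x]≔inside∣≡1+∣p[x]≔outside∣ p x ⟩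
    suc ∣ p [ x ]≔ outside ∣ ∎
    where open ≡-Reasoning

  ∣p+x∣≡1+∣p∣ : {p : Subset n} → x ∉ p → ∣ p [ x ]≔ inside ∣ ≡ suc ∣ p ∣
  ∣p+x∣≡1+∣p∣ {p} x∉p = begin
    ∣ p [ x ]≔ inside ∣      ≡⟨ ∣p[x]≔inside∣≡1+∣p[x]≔outside∣ p x ⟩
    suc ∣ p [ x ]≔ outside ∣ ≡⟨ cong (λ s → suc ∣ p [ x ]≔ s ∣) lookup≡outside ⟨
    suc ∣ p [ x ]≔ lookup p x ∣ ≡⟨ cong (suc ∘ ∣_∣) ([]≔-lookup p x) ⟩
    suc ∣ p ∣                ∎
    where
    open ≡-Reasoning
    lookup≡outside : lookup p x ≡ outside
    lookup≡outside with lookup p x in eq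
    ... | true  = contradiction (lookup⇒[]= x p eq) x∉p
    ... | false = refl

subsetOf : {P : Pred (Fin n) p} → Decidable P → Subset n
subsetOf P? = Vec.tabulate (does ∘ P?)

module _ {P : Pred (Fin n) p} (P? : Decidable P) where

  ∈-subsetOf⁺ : ∀ {x} → P x → x ∈ subsetOf P?
  ∈-subsetOf⁺ {x} Px = lookup⇒[]= x _ (trans (lookup∘tabulate (does ∘ P?) x) (dec-true (P? x) Px))

  ∈-subsetOf⁻ : ∀ {x} → x ∈ subsetOf P? → P x
  ∈-subsetOf⁻ {x} x∈ with P? x | trans (sym (lookup∘tabulate (does ∘ P?) x)) ([]=⇒lookup x∈)
  ... | yes Px | _  = Px
  ... | no _   | ()

  ∣subsetOf∣ : ∣ subsetOf P? ∣ ≡ count P?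
  ∣subsetOf∣ = trans (∣p∣≡count∈ (subsetOf P?)) (count-cong (_∈? subsetOf P?) P? ∈-subsetOf⁻ ∈-subsetOf⁺)

⌈/3⌉≤⇒≤*3 : ∀ m {i} → ⌈ m /3⌉ ≤ i → m ≤ i * 3
⌈/3⌉≤⇒≤*3 m {i} ⌈m/3⌉≤i = +-cancelʳ-≤ 2 m (i * 3) (begin
  m + 2                            ≡⟨ m≡m%n+[m/n]*n (m + 2) 3 ⟩
  (m + 2) % 3 + ((m + 2) / 3) * 3  ≤⟨ +-mono-≤ (ℕ.≤-pred (m%n<n (m + 2) 3)) (*-monoˡ-≤ 3 ⌈m/3⌉≤i) ⟩
  2 + i * 3                        ≡⟨ +-comm 2 (i * 3) ⟩
  i * 3 + 2                        ∎)
  where open ≤-Reasoning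

removable-bound : ∀ n i γ {removable essential} → ⌈ (n + 2 * γ) ∸ 2 /3⌉ ≤ i → removable + essential ≡ suc i →
                  suc i + essential ≤ γ + γ → n ∸ i ≤ removable
removable-bound n i γ {r} {k} ⌈⌉≤i r+k≡1+i bound =
  m≤n+o⇒m∸n≤o n i (+-cancelʳ-≤ k n (i + r) (+-cancelʳ-≤ (suc i) (n + k) (i + r + k) (begin
    n + k + suc i          ≡⟨ shuffle n k i ⟩
    n + (suc i + k)        ≤⟨ +-monoʳ-≤ n bound ⟩
    n + (γ + γ)            ≡⟨ cong (λ g → n + (γ + g)) (+-identityʳ γ) ⟨
    n + 2 * γ              ≤⟨ m≤n+m∸n (n + 2 * γ) 2 ⟩
    2 + (n + 2 * γ ∸ 2)    ≤⟨ +-monoʳ-≤ 2 (⌈/3⌉≤⇒≤*3 _ ⌈⌉≤i) ⟩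
    2 + i * 3              ≡⟨ thrice i ⟩
    i + suc i + suc i      ≡⟨ cong (λ s → i + s + suc i) r+k≡1+i ⟨
    i + (r + k) + suc i    ≡⟨ cong (_+ suc i) (ℕ.+-assoc i r k) ⟨
    i + r + k + suc i      ∎)))
  where
  open ≤-Reasoning
  shuffle : ∀ n k i → n + k + suc i ≡ n + (suc i + k)
  shuffle = solve-∀
  thrice : ∀ i → 2 + i * 3 ≡ i + suc i + suc i
  thrice = solve-∀

least : {P : Pred ℕ p} → Decidable P → ∀ {k} → P k → ∃[ m ] (P m × ∀ {j} → j < m → ¬ P j)
least P? {zero}  P0 = zero , P0 , λ ()
least P? {suc k} Pk with P? zero
... | yes P0 = zero , P0 , λ ()
... | no ¬P0 with least (P? ∘ suc) Pk
...   | m , Pm , below = suc m , Pm , λ { {zero} _ → ¬P0 ; {suc j} (s≤s j<m) → below j<m }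

odd : ℕ → Bool
odd zero    = false
odd (suc k) = not (odd k)

odd-≢-suc : ∀ {k l} → suc k ≡ l → odd k ≢ odd l
odd-≢-suc refl = not-¬ refl

-- Orientations and the handshake lemma

module _ (G : Graph n) where

  Adj? : Decidable₂ (Adj G)
  Adj? u v = adj G u v ≟ᵇ true

  Adj-sym : ∀ {u v} → Adj G u v → Adj G v u
  Adj-sym {u} {v} uv = trans (symm G v u) uv

  Adj-irrefl : ∀ {v} → ¬ Adj G v v
  Adj-irrefl {v} vv = case trans (sym vv) (irrefl G v) of λ ()

  Adj⇒≢ : ∀ {u v} → Adj G u v → u ≢ v
  Adj⇒≢ uv refl = Adj-irrefl uv

  degree : Fin n → ℕ
  degree x = count (λ y → Adj? y x)

  module Orientation {ℓ} {_≺_ : Rel (Fin n) ℓ} (compare : Trichotomous _≡_ _≺_) where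

    lowerDegree : Fin n → ℕ
    lowerDegree x = count (λ y → Adj? y x ×-dec tri⇒dec< compare y x)

    -- Each edge is counted once by ≺ at its larger end and once by ≻ at its smaller end.
    handshake : 2 * ∑[ x < n ] lowerDegree x ≡ ∑[ x < n ] degree x
    handshake = begin
      2 * ∑[ x < n ] lowerDegree x                                   ≡⟨ cong (L +_) (+-identityʳ L) ⟩
      L + L                                                          ≡⟨ cong (L +_) upper≡lower ⟨
      L + ∑[ x < n ] count (λ y → Adj? y x ×-dec ¬? (y ≺? x))         ≡⟨ ∑-distrib-+ lowerDegree _ ⟨
      ∑[ x < n ] (lowerDegree x + count (λ y → Adj? y x ×-dec ¬? (y ≺? x)))
        ≡⟨ sum-cong-≗ (λ x → count-split (λ y → Adj? y x) (λ y → y ≺? x)) ⟨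
      ∑[ x < n ] degree x                                            ∎
      where
      open ≡-Reasoning
      _≺?_ = tri⇒dec< compare
      L = ∑[ x < n ] lowerDegree x
      flipped : ∀ x y → Adj G y x × ¬ (y ≺ x) → Adj G x y × x ≺ y
      flipped x y (yx , y⊀x) with compare x y
      ... | tri< x≺y _ _ = Adj-sym yx , x≺y
      ... | tri≈ _ x≡y _ = contradiction (sym x≡y) (Adj⇒≢ yx)
      ... | tri> _ _ y≺x = contradiction y≺x y⊀x
      unflipped : ∀ x y → Adj G x y × x ≺ y → Adj G y x × ¬ (y ≺ x)
      unflipped x y (xy , x≺y) with compare x y
      ... | tri< _ _ y⊀x = Adj-sym xy , y⊀x
      ... | tri≈ x⊀y _ _ = contradiction x≺y x⊀y
      ... | tri> x⊀y _ _ = contradiction x≺y x⊀y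
      upper≡lower : ∑[ x < n ] count (λ y → Adj? y x ×-dec ¬? (y ≺? x)) ≡ L
      upper≡lower = begin
        ∑[ x < n ] ∑[ y < n ] indicator (Adj? y x ×-dec ¬? (y ≺? x))
          ≡⟨ sum-cong-≗ (λ x → sum-cong-≗ (λ y →
               indicator-cong (flipped x y) (unflipped x y) (Adj? y x ×-dec ¬? (y ≺? x)) (Adj? x y ×-dec (x ≺? y)))) ⟩
        ∑[ x < n ] ∑[ y < n ] indicator (Adj? x y ×-dec (x ≺? y))  ≡⟨ ∑-comm (λ x y → indicator (Adj? x y ×-dec (x ≺? y))) ⟩
        L                                                          ∎

  ∑lowerDegree-invariant : ∀ {ℓ₁ ℓ₂} {_≺₁_ : Rel (Fin n) ℓ₁} {_≺₂_ : Rel (Fin n) ℓ₂}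
                           (compare₁ : Trichotomous _≡_ _≺₁_) (compare₂ : Trichotomous _≡_ _≺₂_) →
                           ∑[ x < n ] Orientation.lowerDegree compare₁ x ≡ ∑[ x < n ] Orientation.lowerDegree compare₂ x
  ∑lowerDegree-invariant compare₁ compare₂ =
    *-cancelˡ-≡ _ _ 2 (trans (Orientation.handshake compare₁) (sym (Orientation.handshake compare₂)))

  edgeCount≡∑lowerDegree : ∀ {ℓ} {_≺_ : Rel (Fin n) ℓ} (compare : Trichotomous _≡_ _≺_) →
                           edgeCount G ≡ ∑[ x < n ] Orientation.lowerDegree compare x
  edgeCount≡∑lowerDegree compare = begin
    edgeCount G
      ≡⟨ length-filter-concatMap-tabulate Edge? (λ u → map (u ,_) (allFin n)) id ⟩
    ∑[ u < n ] length (filter Edge? (map (u ,_) (allFin n)))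
      ≡⟨ sum-cong-≗ (λ u → trans (length-filter-map Edge? (u ,_) (allFin n)) (length-filter-tabulate (Edge? ∘ (u ,_)) id)) ⟩
    ∑[ u < n ] count (λ v → (u <? v) ×-dec Adj? u v)
      ≡⟨ sum-cong-≗ (λ u → count-cong (λ v → (u <? v) ×-dec Adj? u v) (λ v → Adj? v u ×-dec tri⇒dec< ≻-compare v u)
                                       (λ (u<v , uv) → Adj-sym uv , u<v) (λ (vu , u<v) → u<v , Adj-sym vu)) ⟩
    ∑[ u < n ] Orientation.lowerDegree ≻-compare u
      ≡⟨ ∑lowerDegree-invariant ≻-compare compare ⟩
    ∑[ x < n ] Orientation.lowerDegree compare x ∎
    where
    open ≡-Reasoning
    Edge? = λ (e : Fin n × Fin n) → (proj₁ e <? proj₂ e) ×-dec Adj? (proj₁ e) (proj₂ e)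
    ≻-compare = Flip.compare _<ᶠ_ <-cmp

  -- Trees are bipartite

  ProperColouring : (Fin n → Bool) → Set
  ProperColouring c = ∀ {u w} → Adj G u w → c u ≢ c w

  module BreadthFirst (root : Fin n) (connected : Connected G) where

    Within : ℕ → Pred (Fin n) 0ℓ
    Within zero    x = x ≡ root
    Within (suc k) x = Within k x ⊎ ∃[ u ] (Within k u × Adj G u x)

    within? : ∀ k → Decidable (Within k)
    within? zero    x = x ≟ root
    within? (suc k) x = within? k x ⊎-dec any? (λ u → within? k u ×-dec Adj? u x)

    walk⇒within : ∀ {k u v} → Within k u → Walk G u v → ∃[ j ] Within j v
    walk⇒within {k} u∈ nil          = k , u∈
    walk⇒within u∈ (cons uw walk) = walk⇒within (inj₂ (_ , u∈ , uw)) walk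

    depth-spec : ∀ x → ∃[ d ] (Within d x × ∀ {j} → j < d → ¬ Within j x)
    depth-spec x = least (λ k → within? k x) (proj₂ (walk⇒within refl (connected root x)))

    depth : Fin n → ℕ
    depth x = proj₁ (depth-spec x)

    within-depth : ∀ x → Within (depth x) x
    within-depth x = proj₁ (proj₂ (depth-spec x))

    depth-least : ∀ {j x} → Within j x → depth x ≤ j
    depth-least {x = x} x∈ = ≮⇒≥ (λ j<d → proj₂ (proj₂ (depth-spec x)) j<d x∈)

    depth-adj : ∀ {u x} → Adj G u x → depth x ≤ suc (depth u)
    depth-adj {u} ux = depth-least (inj₂ (u , within-depth u , ux))

    depth≡0 : ∀ {x} → depth x ≡ 0 → x ≡ root
    depth≡0 {x} d≡0 = subst (λ k → Within k x) d≡0 (within-depth x)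

    parent : ∀ {x} → x ≢ root → ∃[ u ] (Adj G u x × depth u < depth x)
    parent {x} x≢root with depth x in d≡ | within-depth x
    ... | zero  | x≡root = contradiction x≡root x≢root
    ... | suc j | inj₁ x∈  = contradiction (subst (_≤ j) d≡ (depth-least x∈)) 1+n≰n
    ... | suc j | inj₂ (u , u∈ , ux) = u , ux , s≤s (depth-least u∈)

    depth-root : depth root ≡ 0
    depth-root = n≤0⇒n≡0 (depth-least refl)

    _≺_ : Rel (Fin n) 0ℓ
    x ≺ y = ×-Lex _≡_ _<_ _<ᶠ_ (depth x , x) (depth y , y)

    ≺-compare : Trichotomous _≡_ _≺_
    ≺-compare x y with ×-compare sym ℕ.<-cmp <-cmp (depth x , x) (depth y , y)
    ... | tri< x≺y x≉y y⊀x      = tri< x≺y (λ { refl → x≉y (refl , refl) }) y⊀x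
    ... | tri≈ x⊀y (_ , x≡y) y⊀x = tri≈ x⊀y x≡y y⊀x
    ... | tri> x⊀y x≉y y≺x      = tri> x⊀y (λ { refl → x≉y (refl , refl) }) y≺x

    open Orientation ≺-compare using (lowerDegree)

    lowerNeighbour? : ∀ x → Decidable (λ y → Adj G y x × y ≺ x)
    lowerNeighbour? x y = Adj? y x ×-dec tri⇒dec< ≺-compare y x

    lowerDegree-nonroot : ∀ {x} → x ≢ root → 1 ≤ lowerDegree x
    lowerDegree-nonroot x≢root with parent x≢root
    ... | p , px , dp<dx = count-pos (lowerNeighbour? _) (px , inj₁ dp<dx)

    level-edge⇒≢root : ∀ {w u} → depth w ≡ depth u → w <ᶠ u → u ≢ root
    level-edge⇒≢root dw≡du w<u refl = <⇒≢ᶠ w<u (depth≡0 (trans dw≡du depth-root))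

    lowerDegree-level-edge : ∀ {w u} → Adj G w u → depth w ≡ depth u → w <ᶠ u → 2 ≤ lowerDegree u
    lowerDegree-level-edge {w} {u} wu dw≡du w<u with parent (level-edge⇒≢root dw≡du w<u)
    ... | p , pu , dp<du = count-≥2 (lowerNeighbour? u) (pu , inj₁ dp<du) (wu , inj₂ (dw≡du , w<u))
                                    (λ { refl → <⇒≢ dp<du dw≡du })

    level-edge⇒edgeCount : ∀ {w u} → Adj G w u → depth w ≡ depth u → w <ᶠ u → suc (n ∸ 1) ≤ edgeCount G
    level-edge⇒edgeCount {w} {u} wu dw≡du w<u = begin
      suc (n ∸ 1)                                                ≡⟨ +-comm 1 (n ∸ 1) ⟩
      n ∸ 1 + 1                                                  ≡⟨ cong₂ _+_ (count-≢ root) (count-≡ u) ⟨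
      count (∁? (_≟ root)) + count (_≟ u)                        ≡⟨ ∑-distrib-+ (indicator ∘ ∁? (_≟ root)) (indicator ∘ (_≟ u)) ⟨
      ∑[ x < n ] (indicator (¬? (x ≟ root)) + indicator (x ≟ u))  ≤⟨ ∑-mono-≤ pointwise ⟩
      ∑[ x < n ] lowerDegree x                                   ≡⟨ edgeCount≡∑lowerDegree ≺-compare ⟨
      edgeCount G                                                ∎
      where
      open ≤-Reasoning
      pointwise : ∀ x → indicator (¬? (x ≟ root)) + indicator (x ≟ u) ≤ lowerDegree x
      pointwise x with x ≟ root | x ≟ u
      ... | yes refl | yes refl = ⊥-elim (level-edge⇒≢root dw≡du w<u refl)
      ... | yes _    | no _     = z≤n
      ... | no x≢r   | no _     = lowerDegree-nonroot x≢r
      ... | no _     | yes refl = lowerDegree-level-edge wu dw≡du w<u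

    no-level-edge : edgeCount G ≡ n ∸ 1 → ∀ {u w} → Adj G u w → depth u ≢ depth w
    no-level-edge edges {u} {w} uw du≡dw = 1+n≰n (subst (suc (n ∸ 1) ≤_) edges bound)
      where
      bound : suc (n ∸ 1) ≤ edgeCount G
      bound with <-cmp u w
      ... | tri< u<w _ _ = level-edge⇒edgeCount uw du≡dw u<w
      ... | tri≈ _ u≡w _ = contradiction u≡w (Adj⇒≢ uw)
      ... | tri> _ _ w<u = level-edge⇒edgeCount (Adj-sym uw) (sym du≡dw) w<u

    odd-depth-proper : edgeCount G ≡ n ∸ 1 → ProperColouring (odd ∘ depth)
    odd-depth-proper edges {u} {w} uw with ℕ.<-cmp (depth u) (depth w)
    ... | tri< du<dw _ _ = odd-≢-suc (≤-antisym du<dw (depth-adj uw))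
    ... | tri≈ _ du≡dw _ = contradiction du≡dw (no-level-edge edges uw)
    ... | tri> _ _ dw<du = ≢-sym (odd-≢-suc (≤-antisym dw<du (depth-adj (Adj-sym uw))))

  tree-colourable : IsTree G → ∃ ProperColouring
  tree-colourable (n≥1 , connected , edges) = odd ∘ depth , odd-depth-proper edges
    where open BreadthFirst (fromℕ< n≥1) connected

  -- Independent sets are no larger than Γ

  HasNeighbourIn : Pred (Fin n) p → Pred (Fin n) p
  HasNeighbourIn P x = ∃[ u ] (P u × Adj G u x)

  hasNeighbourIn? : {P : Pred (Fin n) p} → Decidable P → Decidable (HasNeighbourIn P)
  hasNeighbourIn? P? x = any? (λ u → P? u ×-dec Adj? u x)

  Dominated : Subset n → Pred (Fin n) 0ℓ
  Dominated S x = x ∈ S ⊎ HasNeighbourIn (_∈ S) x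

  undominated : (S : Subset n) → ¬ Dominating G S → ∃[ x ] ¬ Dominated S x
  undominated S = ¬∀⟶∃¬ n (Dominated S) (λ x → (x ∈? S) ⊎-dec hasNeighbourIn? (_∈? S) x)

  dominating-⊆ : ∀ {S S′} → S ⊆ˢ S′ → Dominating G S → Dominating G S′
  dominating-⊆ S⊆S′ dominating x with dominating x
  ... | inj₁ x∈S             = inj₁ (S⊆S′ x∈S)
  ... | inj₂ (u , u∈S , ux) = inj₂ (u , S⊆S′ u∈S , ux)

  Independent : Pred (Fin n) p → Set p
  Independent I = ∀ {x y} → I x → I y → ¬ Adj G x y

  independent-dominating⇒minimal : {M : Subset n} → Independent (_∈ M) → Dominating G M → MinimalDominating G M
  independent-dominating⇒minimal independent dominating = dominating , not-smaller
    where
    not-smaller : ∀ S′ → S′ ⊂ _ → ¬ Dominating G S′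
    not-smaller S′ (S′⊆M , x , x∈M , x∉S′) S′-dominating with S′-dominating x
    ... | inj₁ x∈S′              = x∉S′ x∈S′
    ... | inj₂ (u , u∈S′ , ux) = independent (S′⊆M u∈S′) x∈M ux

  module _ {M : Subset n} {x : Fin n} (x-undominated : ¬ Dominated M x) where

    undominated⇒∉ : x ∉ M
    undominated⇒∉ = x-undominated ∘ inj₁

    independent-insert : Independent (_∈ M) → Independent (_∈ M [ x ]≔ inside)
    independent-insert independent {y} {z} y∈ z∈ yz with y ≟ x | z ≟ x
    ... | yes refl | yes refl = Adj-irrefl yz
    ... | yes refl | no z≢x   = x-undominated (inj₂ (z , ∈-update⁻ z≢x z∈ , Adj-sym yz))
    ... | no y≢x   | yes refl = x-undominated (inj₂ (y , ∈-update⁻ y≢x y∈ , yz))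
    ... | no y≢x   | no z≢x   = independent (∈-update⁻ y≢x y∈) (∈-update⁻ z≢x z∈) yz

  maximal-independent : (M : Subset n) → Independent (_∈ M) →
                        ∃[ M′ ] (M ⊆ˢ M′ × Independent (_∈ M′) × Dominating G M′)
  maximal-independent M = grow (n ∸ ∣ M ∣) M (m+[n∸m]≡n (∣p∣≤n M))
    where
    grow : ∀ k (M : Subset n) → ∣ M ∣ + k ≡ n → Independent (_∈ M) →
           ∃[ M′ ] (M ⊆ˢ M′ × Independent (_∈ M′) × Dominating G M′)
    grow k M size independent with dominating? G M
    ... | yes dominating = M , id , independent , dominating
    ... | no ¬dominating with undominated M ¬dominating | k
    ...   | x , x-undominated | zero = contradiction (∣p∣≤n (M [ x ]≔ inside)) too-big
      where
      too-big : ¬ ∣ M [ x ]≔ inside ∣ ≤ n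
      too-big = 1+n≰n ∘ subst₂ _≤_ (∣p+x∣≡1+∣p∣ (undominated⇒∉ x-undominated)) (trans (sym size) (+-identityʳ ∣ M ∣))
    ...   | x , x-undominated | suc k
      with M′ , M+x⊆M′ , independent′ , dominating′ ←
           grow k (M [ x ]≔ inside)
                (trans (cong (_+ k) (∣p+x∣≡1+∣p∣ (undominated⇒∉ x-undominated))) (trans (sym (+-suc ∣ M ∣ k)) size))
                (independent-insert x-undominated independent)
      = M′ , M+x⊆M′ ∘ ⊆-insert M , independent′ , dominating′

  Γ-Bound : ℕ → Set
  Γ-Bound γ = ∀ S → MinimalDominating G S → ∣ S ∣ ≤ γ

  independent⇒count≤Γ : ∀ {γ} → Γ-Bound γ → {I : Pred (Fin n) p} (I? : Decidable I) → Independent I → count I? ≤ γ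
  independent⇒count≤Γ {γ = γ} Γ-bound I? independent
    with M , I⊆M , independent′ , dominating ←
         maximal-independent (subsetOf I?) (λ x∈ y∈ → independent (∈-subsetOf⁻ I? x∈) (∈-subsetOf⁻ I? y∈))
    = begin
      count I?           ≡⟨ ∣subsetOf∣ I? ⟨
      ∣ subsetOf I? ∣    ≤⟨ p⊆q⇒∣p∣≤∣q∣ I⊆M ⟩
      ∣ M ∣              ≤⟨ Γ-bound M (independent-dominating⇒minimal independent′ dominating) ⟩
      γ                  ∎
    where open ≤-Reasoning

  -- Essential vertices of a dominating set

  removable? : (S : Subset n) → Decidable (λ v → v ∈ S × Dominating G (S [ v ]≔ outside))
  removable? S v = (v ∈? S) ×-dec dominating? G (S [ v ]≔ outside)

  essential? : (S : Subset n) → Decidable (λ v → v ∈ S × ¬ Dominating G (S [ v ]≔ outside))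
  essential? S v = (v ∈? S) ×-dec ¬? (dominating? G (S [ v ]≔ outside))

  module Partition (S : Subset n) where

    Isolated : Pred (Fin n) 0ℓ
    Isolated x = x ∈ S × ¬ HasNeighbourIn (_∈ S) x

    Core : Pred (Fin n) 0ℓ
    Core x = x ∈ S × HasNeighbourIn (_∈ S) x

    Far : Pred (Fin n) 0ℓ
    Far x = x ∉ S × ¬ HasNeighbourIn Isolated x

    isolated? : Decidable Isolated
    isolated? x = (x ∈? S) ×-dec ¬? (hasNeighbourIn? (_∈? S) x)

    core? : Decidable Core
    core? x = (x ∈? S) ×-dec hasNeighbourIn? (_∈? S) x

    far? : Decidable Far
    far? x = ¬? (x ∈? S) ×-dec ¬? (hasNeighbourIn? isolated? x)

    module PrivateNeighbour (S-dominating : Dominating G S) {v} (v∈S : v ∈ S)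
                            (essential : ¬ Dominating G (S [ v ]≔ outside))
                            (v-has-neighbour : HasNeighbourIn (_∈ S) v) where

      private
        witness : ∃[ x ] ¬ Dominated (S [ v ]≔ outside) x
        witness = undominated (S [ v ]≔ outside) essential

      x : Fin n
      x = proj₁ witness

      only-v : ∀ {u} → u ∈ S → Adj G u x → u ≡ v
      only-v {u} u∈S ux with u ≟ v
      ... | yes u≡v = u≡v
      ... | no u≢v  = contradiction (inj₂ (u , ∈-update⁺ u≢v u∈S , ux)) (proj₂ witness)

      x≢v : x ≢ v
      x≢v x≡v = let (u , u∈S , uv) = v-has-neighbour in
        Adj⇒≢ uv (only-v u∈S (subst (Adj G u) (sym x≡v) uv))

      x∉S : x ∉ S
      x∉S x∈S = proj₂ witness (inj₁ (∈-update⁺ x≢v x∈S))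

      v-adj-x : Adj G v x
      v-adj-x with S-dominating x
      ... | inj₁ x∈S             = contradiction x∈S x∉S
      ... | inj₂ (u , u∈S , ux) = subst (λ u → Adj G u x) (only-v u∈S ux) ux

      x-far : Far x
      x-far = x∉S , λ (u , (u∈S , u-alone) , ux) →
        u-alone (subst (HasNeighbourIn (_∈ S)) (sym (only-v u∈S ux)) v-has-neighbour)

    EssentialWithNeighbour : Pred (Fin n) 0ℓ
    EssentialWithNeighbour v = (v ∈ S × ¬ Dominating G (S [ v ]≔ outside)) × HasNeighbourIn (_∈ S) v

    essential≤isolated+far : Dominating G S → count (essential? S) ≤ count isolated? + count far?
    essential≤isolated+far S-dominating = begin
      count (essential? S)
        ≡⟨ count-split (essential? S) (hasNeighbourIn? (_∈? S)) ⟩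
      count (essential? S ∩? hasNeighbourIn? (_∈? S)) + count (essential? S ∩? ∁? (hasNeighbourIn? (_∈? S)))
        ≤⟨ +-mono-≤ (count-injection (essential? S ∩? hasNeighbourIn? (_∈? S)) far? private-neighbour
                                     (λ ((v∈S , ess) , nbr) → PrivateNeighbour.x-far S-dominating v∈S ess nbr)
                                     private-neighbour-injective)
                    (count-mono (essential? S ∩? ∁? (hasNeighbourIn? (_∈? S))) isolated? (λ ((v∈S , _) , alone) → v∈S , alone)) ⟩
      count far? + count isolated?
        ≡⟨ +-comm (count far?) (count isolated?) ⟩
      count isolated? + count far? ∎
      where
      open ≤-Reasoning
      private-neighbour : ∀ {v} → EssentialWithNeighbour v → Fin n
      private-neighbour ((v∈S , ess) , nbr) = PrivateNeighbour.x S-dominating v∈S ess nbr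
      private-neighbour-injective : ∀ {v v′} (p : EssentialWithNeighbour v) (p′ : EssentialWithNeighbour v′) →
                                    private-neighbour p ≡ private-neighbour p′ → v ≡ v′
      private-neighbour-injective ((v∈S , ess) , nbr) ((v′∈S , ess′) , nbr′) x≡x′ =
        sym (PrivateNeighbour.only-v S-dominating v∈S ess nbr v′∈S
               (subst (Adj G _) (sym x≡x′) (PrivateNeighbour.v-adj-x S-dominating v′∈S ess′ nbr′)))

    Rest : Pred (Fin n) 0ℓ
    Rest = Core ∪ Far

    rest? : Decidable Rest
    rest? = core? ∪? far?

    core⊥far : Core ⊥ Far
    core⊥far ((x∈S , _) , (x∉S , _)) = x∉S x∈S

    isolated-neighbour : ∀ {x y} → Isolated x → Adj G x y → y ∉ S × HasNeighbourIn Isolated y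
    isolated-neighbour {x} (x∈S , alone) xy = (λ y∈S → alone (_ , y∈S , Adj-sym xy)) , (x , (x∈S , alone) , xy)

    module _ {C : Pred (Fin n) p} where

      isolated⊥rest∩C : Isolated ⊥ (Rest ∩ C)
      isolated⊥rest∩C ((_ , alone) , (inj₁ (_ , has) , _)) = alone has
      isolated⊥rest∩C ((x∈S , _) , (inj₂ (x∉S , _) , _))   = x∉S x∈S

      beyond-isolated : ∀ {y} → y ∉ S × HasNeighbourIn Isolated y → ¬ (Isolated ∪ (Rest ∩ C)) y
      beyond-isolated (y∉S , _) (inj₁ (y∈S , _))            = y∉S y∈S
      beyond-isolated (y∉S , _) (inj₂ (inj₁ (y∈S , _) , _)) = y∉S y∈S
      beyond-isolated (_ , has) (inj₂ (inj₂ (_ , ¬has) , _)) = ¬has has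

      isolated∪rest∩C-independent : Independent C → Independent (Isolated ∪ (Rest ∩ C))
      isolated∪rest∩C-independent C-independent x∈ y∈ xy with x∈ | y∈
      ... | inj₁ x-isolated | _               = beyond-isolated (isolated-neighbour x-isolated xy) y∈
      ... | _               | inj₁ y-isolated = beyond-isolated (isolated-neighbour y-isolated (Adj-sym xy)) x∈
      ... | inj₂ (_ , Cx)   | inj₂ (_ , Cy)   = C-independent Cx Cy xy

      isolated+rest∩C≤Γ : ∀ {γ} → Γ-Bound γ → (C? : Decidable C) → Independent C →
                          count isolated? + count (rest? ∩? C?) ≤ γ
      isolated+rest∩C≤Γ {γ} Γ-bound C? C-independent =
        subst (_≤ γ) (count-∪ isolated? (rest? ∩? C?) isolated⊥rest∩C)
          (independent⇒count≤Γ Γ-bound (isolated? ∪? (rest? ∩? C?)) (isolated∪rest∩C-independent C-independent))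

  -- The two colour classes together cover Isolated twice and Rest once.
  size+essential≤2Γ : ∀ {γ c} → Γ-Bound γ → ProperColouring c →
                      (S : Subset n) → Dominating G S → ∣ S ∣ + count (essential? S) ≤ γ + γ
  size+essential≤2Γ {γ} {c} Γ-bound proper S S-dominating = begin
    ∣ S ∣ + count (essential? S)
      ≡⟨ cong (_+ count (essential? S)) (trans (∣p∣≡count∈ S) (count-split (_∈? S) (hasNeighbourIn? (_∈? S)))) ⟩
    (count core? + count isolated?) + count (essential? S)
      ≤⟨ +-monoʳ-≤ (count core? + count isolated?) (essential≤isolated+far S-dominating) ⟩
    (count core? + count isolated?) + (count isolated? + count far?)
      ≡⟨ cong (_+ (count isolated? + count far?)) (+-comm (count core?) (count isolated?)) ⟩
    (count isolated? + count core?) + (count isolated? + count far?)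
      ≡⟨ +-interchange (count isolated?) (count core?) (count isolated?) (count far?) ⟩
    (count isolated? + count isolated?) + (count core? + count far?)
      ≡⟨ cong ((count isolated? + count isolated?) +_) rest-by-colour ⟩
    (count isolated? + count isolated?) + (count (rest? ∩? red?) + count (rest? ∩? ∁? red?))
      ≡⟨ +-interchange (count isolated?) (count isolated?) (count (rest? ∩? red?)) (count (rest? ∩? ∁? red?)) ⟩
    (count isolated? + count (rest? ∩? red?)) + (count isolated? + count (rest? ∩? ∁? red?))
      ≤⟨ +-mono-≤ (isolated+rest∩C≤Γ Γ-bound red? red-independent)
                  (isolated+rest∩C≤Γ Γ-bound (∁? red?) blue-independent) ⟩
    γ + γ ∎
    where
    open ≤-Reasoning
    open Partition S
    red? : Decidable (λ x → c x ≡ true)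
    red? x = c x ≟ᵇ true
    red-independent : Independent (λ x → c x ≡ true)
    red-independent cx cy xy = proper xy (trans cx (sym cy))
    blue-independent : Independent (∁ (λ x → c x ≡ true))
    blue-independent ¬cx ¬cy xy = proper xy (trans (¬-not ¬cx) (sym (¬-not ¬cy)))
    rest-by-colour : count core? + count far? ≡ count (rest? ∩? red?) + count (rest? ∩? ∁? red?)
    rest-by-colour = trans (sym (count-∪ core? far? core⊥far)) (count-split rest? red?)

  -- Double counting

  module DoubleCounting (i : ℕ) where

    dominatingOfSize? : ∀ j → Decidable (λ S → Dominating G S × ∣ S ∣ ≡ j)
    dominatingOfSize? j S = dominating? G S ×-dec (∣ S ∣ ≟ℕ j)

    domCount≡∑ˢ : ∀ j → domCount G j ≡ ∑ˢ (indicator ∘ dominatingOfSize? j)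
    domCount≡∑ˢ j = length-filter-allSubsets (dominatingOfSize? j)

    removal : Subset n → Fin n → ℕ
    removal S v = indicator (removable? S v ×-dec dominatingOfSize? (suc i) S)

    insertion : Subset n → Fin n → ℕ
    insertion D v = indicator (¬? (v ∈? D) ×-dec dominatingOfSize? i D)

    -- The left-hand sides are removal S v and insertion D v unfolded, so that `with` can abstract the membership test.
    removal-by-membership : ∀ S v →
      indicator (((v ∈? S) ×-dec dominating? G (S [ v ]≔ outside)) ×-dec dominatingOfSize? (suc i) S)
        ≡ (if does (v ∈? S) then indicator (dominatingOfSize? i (S [ v ]≔ outside)) else 0)
    removal-by-membership S v with v ∈? S
    ... | no _    = refl
    ... | yes v∈S = indicator-cong
      (λ ((_ , dominating′) , _ , size) → dominating′ , ℕ.suc-injective (trans (sym (∣p∣≡1+∣p-x∣ v∈S)) size))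
      (λ (dominating′ , size′) → (v∈S , dominating′) ,
                                  dominating-⊆ ∈-removed⁻ dominating′ , trans (∣p∣≡1+∣p-x∣ v∈S) (cong suc size′))
      ((yes v∈S ×-dec dominating? G (S [ v ]≔ outside)) ×-dec dominatingOfSize? (suc i) S)
      (dominatingOfSize? i (S [ v ]≔ outside))

    insertion-by-membership : ∀ D v →
      indicator (¬? (v ∈? D) ×-dec dominatingOfSize? i D)
        ≡ (if does (v ∈? D) then 0 else indicator (dominatingOfSize? i D))
    insertion-by-membership D v with v ∈? D
    ... | yes _ = refl
    ... | no _  = refl

    removals≡insertions : ∀ v → ∑ˢ (λ S → removal S v) ≡ ∑ˢ (λ D → insertion D v)
    removals≡insertions v = begin
      ∑ˢ (λ S → removal S v)
        ≡⟨ ∑ˢ-cong (λ S → removal-by-membership S v) ⟩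
      ∑ˢ (λ S → if does (v ∈? S) then indicator (dominatingOfSize? i (S [ v ]≔ outside)) else 0)
        ≡⟨ ∑ˢ-remove (indicator ∘ dominatingOfSize? i) v ⟩
      ∑ˢ (λ D → if does (v ∈? D) then 0 else indicator (dominatingOfSize? i D))
        ≡⟨ ∑ˢ-cong (λ D → insertion-by-membership D v) ⟨
      ∑ˢ (λ D → insertion D v) ∎
      where open ≡-Reasoning

    module _ {γ c} (Γ-bound : Γ-Bound γ) (proper : ProperColouring c) (⌈⌉≤i : ⌈ (n + 2 * γ) ∸ 2 /3⌉ ≤ i) where

      removable-lower : ∀ S → indicator (dominatingOfSize? (suc i) S) * (n ∸ i)
                              ≤ indicator (dominatingOfSize? (suc i) S) * count (removable? S)
      removable-lower S = indicator-*-mono bound (dominatingOfSize? (suc i) S)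
        where
        bound : Dominating G S × ∣ S ∣ ≡ suc i → n ∸ i ≤ count (removable? S)
        bound (dominating , size) = removable-bound n i γ ⌈⌉≤i
          (trans (sym (count-split (_∈? S) (λ v → dominating? G (S [ v ]≔ outside)))) (trans (sym (∣p∣≡count∈ S)) size))
          (subst (λ s → s + count (essential? S) ≤ γ + γ) size (size+essential≤2Γ Γ-bound proper S dominating))

      outside-upper : ∀ D → indicator (dominatingOfSize? i D) * count (λ v → ¬? (v ∈? D))
                            ≤ indicator (dominatingOfSize? i D) * (n ∸ i)
      outside-upper D = indicator-*-mono (λ (_ , size) → ≤-reflexive (trans (count-∉ D) (cong (n ∸_) size)))
                                         (dominatingOfSize? i D)

      domCount-step : domCount G (suc i) * (n ∸ i) ≤ domCount G i * (n ∸ i)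
      domCount-step = begin
        domCount G (suc i) * (n ∸ i)
          ≡⟨ cong (_* (n ∸ i)) (domCount≡∑ˢ (suc i)) ⟩
        ∑ˢ (indicator ∘ dominatingOfSize? (suc i)) * (n ∸ i)
          ≡⟨ ∑ˢ-*ʳ (indicator ∘ dominatingOfSize? (suc i)) (n ∸ i) ⟨
        ∑ˢ (λ S → indicator (dominatingOfSize? (suc i) S) * (n ∸ i))
          ≤⟨ ∑ˢ-mono-≤ removable-lower ⟩
        ∑ˢ (λ S → indicator (dominatingOfSize? (suc i) S) * count (removable? S))
          ≡⟨ ∑ˢ-cong (λ S → count-×-const (removable? S) (dominatingOfSize? (suc i) S)) ⟨
        ∑ˢ (λ S → ∑[ v < n ] removal S v)
          ≡⟨ ∑ˢ-∑-comm removal ⟩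
        ∑[ v < n ] ∑ˢ (λ S → removal S v)
          ≡⟨ sum-cong-≗ removals≡insertions ⟩
        ∑[ v < n ] ∑ˢ (λ D → insertion D v)
          ≡⟨ ∑ˢ-∑-comm insertion ⟨
        ∑ˢ (λ D → ∑[ v < n ] insertion D v)
          ≡⟨ ∑ˢ-cong (λ D → count-×-const (λ v → ¬? (v ∈? D)) (dominatingOfSize? i D)) ⟩
        ∑ˢ (λ D → indicator (dominatingOfSize? i D) * count (λ v → ¬? (v ∈? D)))
          ≤⟨ ∑ˢ-mono-≤ outside-upper ⟩
        ∑ˢ (λ D → indicator (dominatingOfSize? i D) * (n ∸ i))
          ≡⟨ ∑ˢ-*ʳ (indicator ∘ dominatingOfSize? i) (n ∸ i) ⟩
        ∑ˢ (indicator ∘ dominatingOfSize? i) * (n ∸ i)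
          ≡⟨ cong (_* (n ∸ i)) (domCount≡∑ˢ i) ⟨
        domCount G i * (n ∸ i) ∎
        where open ≤-Reasoning

theorem16 : ∀ (n : ℕ) (T : Graph n) (γ : ℕ) → IsTree T → IsUpperDominationNumber T γ →
    ∀ (i : ℕ) → ⌈ (n + 2 * γ) ∸ 2 /3⌉ ≤ i → i < n → domCount T (suc i) ≤ domCount T i
theorem16 n T γ tree (_ , Γ-bound) i ⌈⌉≤i i<n =
  *-cancelʳ-≤ _ _ (n ∸ i) {{>-nonZero (m<n⇒0<n∸m i<n)}}
    (DoubleCounting.domCount-step T i Γ-bound (proj₂ (tree-colourable T tree)) ⌈⌉≤i)
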